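{- For every finite set $X$, the internal coproduct $\Gamma$ and the external coproduct $\Delta$ on $\mathbb T_X$ satisfy $$(I\otimes\Delta)\circ\Gamma=m^{1,3}\circ(\Gamma\otimes\Gamma)\circ\Delta$$ as maps $\mathbb T_X\to\bigoplus_{Y\subset X}\mathbb T_X\otimes\mathbb T_{X\setminus Y}\otimes\mathbb T_Y$, where $m^{1,3}:\mathbb T_{X\setminus Y}\otimes\mathbb T_{X\setminus Y}\otimes\mathbb T_Y\otimes\mathbb T_Y\to\mathbb T_X\otimes\mathbb T_{X\setminus Y}\otimes\mathbb T_Y$ is $a\otimes b\otimes c\otimes d\mapsto ac\otimes b\otimes d$.
   Context: For a finite set $X$, $\mathbb T_X$ is the vector space freely generated by topologies on $X$. Product: for disjoint $X_1,X_2$, $\mathcal T_1\mathcal T_2$ is the topology on $X_1\sqcup X_2$ with $Y$ open iff $Y\cap X_i\in\mathcal T_i$ for $i=1,2$. For $Y\subset X$, $\mathcal T|_Y=\{Z\cap Y:Z\in\mathcal T\}$. External coproduct: $\Delta(\mathcal T)=\sum_{Y\in\mathcal T}\mathcal T|_{X\setminus Y}\otimes\mathcal T|_Y$. For a topology $\mathcal T$, $x\le_{\mathcal T}y$ iff every open set containing $x$ contains $y$ (open sets = final segments); $x\sim_{\mathcal T}y$ iff $x\le_{\mathcal T}y\le_{\mathcal T}x$. $\mathcal T'\prec\mathcal T$ means every $\mathcal T$-open set is $\mathcal T'$-open. For $\mathcal T'\prec\mathcal T$, $\mathcal T/\mathcal T'$ is the topology on $X$ whose quasi-order is the transitive closure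 of $x\,\mathcal R\,y\iff(x\le_{\mathcal T}y\text{ or }y\le_{\mathcal T'}x)$. $Y$ is $\mathcal T$-connected if $(Y,\mathcal T|_Y)$ is connected. $\mathcal T'$ is $\mathcal T$-admissible if $\mathcal T'\prec\mathcal T$, $\mathcal T'|_Y=\mathcal T|_Y$ for all $\mathcal T'$-connected $Y$, and $x\sim_{\mathcal T/\mathcal T'}y\iff x\sim_{\mathcal T'/\mathcal T'}y$. Internal coproduct: $\Gamma(\mathcal T)=\sum_{\mathcal T'\ \mathcal T\text{ -admissible}}\mathcal T'\otimes\mathcal T/\mathcal T'$ (on $\mathbb T_{X\setminus Y}$ and $\mathbb T_Y$, $\Gamma$ is defined in the same way). -}

module Defs where

-- Finite topologies on X = Fin n, the external coproduct Δ and the internal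
-- coproduct Γ, with linear combinations represented as finite multisets
-- (lists compared up to permutation) of canonical basis elements.

open import Data.Bool using (Bool; true; false; _∧_; _∨_; not; if_then_else_)
open import Data.Nat using (ℕ; zero; suc)
open import Data.Fin using (Fin)
open import Data.Fin.Subset using (Subset; _∩_; _∪_; ∁; ⊤; ⊥)
open import Data.Vec using ([]; _∷_; lookup)
open import Data.List using (List; []; _∷_; _++_; map; concatMap; filterᵇ; allFin; cartesianProduct)
open import Data.Product using (_×_; _,_)
open import Data.Bool.ListAction using (all; any)

private
  variable
    n : ℕ

subsets : (n : ℕ) → List (Subset n)
subsets zero    = [] ∷ []
subsets (suc n) = map (false ∷_) (subsets n) ++ map (true ∷_) (subsets n)

_∈ᵇ_ : Fin n → Subset n → Bool
x ∈ᵇ s = lookup s x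

_⊆ᵇ_ : Subset n → Subset n → Bool
_⊆ᵇ_ {n} s t = all (λ x → not (x ∈ᵇ s) ∨ (x ∈ᵇ t)) (allFin n)

_=ˢ_ : Subset n → Subset n → Bool
s =ˢ t = (s ⊆ᵇ t) ∧ (t ⊆ᵇ s)

nonEmpty : Subset n → Bool
nonEmpty {n} s = any (λ x → x ∈ᵇ s) (allFin n)

_=ᵇ_ : Bool → Bool → Bool
true  =ᵇ b = b
false =ᵇ b = not b

-- Families of subsets of Fin n, canonically encoded as a binary tree
-- indexed by the characteristic vector (so ≡ is equality of families).

Fam : ℕ → Set
Fam zero    = Bool
Fam (suc n) = Fam n × Fam n   -- (members not containing 0 , members containing 0)

_∈F_ : Subset n → Fam n → Bool
[]          ∈F b       = b
(false ∷ s) ∈F (f , g) = s ∈F f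
(true  ∷ s) ∈F (f , g) = s ∈F g

fromPred : (Subset n → Bool) → Fam n
fromPred {zero}  p = p []
fromPred {suc n} p = fromPred (λ s → p (false ∷ s)) , fromPred (λ s → p (true ∷ s))

allFams : (n : ℕ) → List (Fam n)
allFams zero    = false ∷ true ∷ []
allFams (suc n) = cartesianProduct (allFams n) (allFams n)

_=F_ : Fam n → Fam n → Bool
_=F_ {n} F G = all (λ Z → (Z ∈F F) =ᵇ (Z ∈F G)) (subsets n)

isTopOn : Subset n → Fam n → Bool
isTopOn {n} S F =
  all (λ Z → not (Z ∈F F) ∨ (Z ⊆ᵇ S)) (subsets n)
  ∧ (⊥ ∈F F) ∧ (S ∈F F)
  ∧ all (λ Z → all (λ W → not ((Z ∈F F) ∧ (W ∈F F))
                          ∨ (((Z ∪ W) ∈F F) ∧ ((Z ∩ W) ∈F F)))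
                   (subsets n)) (subsets n)

topsOn : Subset n → List (Fam n)
topsOn {n} S = filterᵇ (isTopOn S) (allFams n)

restrict : Fam n → Subset n → Fam n
restrict {n} T Y = fromPred (λ W → any (λ Z → (Z ∈F T) ∧ ((Z ∩ Y) =ˢ W)) (subsets n))

product : Subset n → Subset n → Fam n → Fam n → Fam n
product X₁ X₂ T₁ T₂ =
  fromPred (λ Z → (Z ⊆ᵇ (X₁ ∪ X₂)) ∧ ((Z ∩ X₁) ∈F T₁) ∧ ((Z ∩ X₂) ∈F T₂))

leq : Fam n → Fin n → Fin n → Bool
leq {n} T x y = all (λ Z → not ((Z ∈F T) ∧ (x ∈ᵇ Z)) ∨ (y ∈ᵇ Z)) (subsets n)

sim : Fam n → Fin n → Fin n → Bool
sim T x y = leq T x y ∧ leq T y x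

finer : Fam n → Fam n → Bool
finer {n} T' T = all (λ Z → not (Z ∈F T) ∨ (Z ∈F T')) (subsets n)

-- paths of length ≤ k+1 for a relation R
reach : ℕ → (Fin n → Fin n → Bool) → Fin n → Fin n → Bool
reach zero    R x y = R x y
reach {n} (suc k) R x y = R x y ∨ any (λ z → R x z ∧ reach k R z y) (allFin n)

-- transitive closure of R (paths of length ≤ n+1 suffice on Fin n)
transClosure : (Fin n → Fin n → Bool) → Fin n → Fin n → Bool
transClosure {n} R = reach n R

-- T/T' for topologies T, T' on S: the topology on S whose quasi-order is the
-- transitive closure of  x R y ⇔ (x ≤_T y or y ≤_T' x)  (x, y ∈ S);
-- its open sets are the final segments of that quasi-order.
quotient : Subset n → Fam n → Fam n → Fam n
quotient {n} S T T' =
  fromPred (λ Z → (Z ⊆ᵇ S)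
    ∧ all (λ x → all (λ y → not ((x ∈ᵇ Z) ∧ transClosure R x y) ∨ (y ∈ᵇ Z))
                     (allFin n)) (allFin n))
  where
  R : Fin n → Fin n → Bool
  R x y = (x ∈ᵇ S) ∧ (y ∈ᵇ S) ∧ (leq T x y ∨ leq T' y x)

connected : Fam n → Subset n → Bool
connected {n} T Y =
  not (any (λ U → (U ⊆ᵇ Y) ∧ (U ∈F restrict T Y) ∧ ((Y ∩ ∁ U) ∈F restrict T Y)
                  ∧ nonEmpty U ∧ nonEmpty (Y ∩ ∁ U))
           (subsets n))

admissible : Subset n → Fam n → Fam n → Bool
admissible {n} S T T' =
  finer T' T
  ∧ all (λ Y → not ((Y ⊆ᵇ S) ∧ connected T' Y) ∨ (restrict T' Y =F restrict T Y))
        (subsets n)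
  ∧ all (λ x → all (λ y → not ((x ∈ᵇ S) ∧ (y ∈ᵇ S))
                          ∨ (sim (quotient S T T') x y =ᵇ sim (quotient S T' T') x y))
                   (allFin n)) (allFin n)

Γ : Subset n → Fam n → List (Fam n × Fam n)
Γ S T = map (λ T' → T' , quotient S T T') (filterᵇ (admissible S T) (topsOn S))

-- External coproduct on 𝕋_X (X = Fin n):
-- Δ(T) = Σ_{Y ∈ T} T|_{X∖Y} ⊗ T|_Y , the summand of index Y lying in
-- 𝕋_{X∖Y} ⊗ 𝕋_Y (recorded as the triple (Y , T|_{X∖Y} , T|_Y)).
Δ : Fam n → List (Subset n × Fam n × Fam n)
Δ {n} T = map (λ Y → Y , restrict T (∁ Y) , restrict T Y) (filterᵇ (λ Y → Y ∈F T) (subsets n))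

-- basis elements of ⊕_{Y ⊆ X} 𝕋_X ⊗ 𝕋_{X∖Y} ⊗ 𝕋_Y
Target : ℕ → Set
Target n = Subset n × Fam n × Fam n × Fam n

-- (I ⊗ Δ) ∘ Γ  applied to a topology T on X
lhs : Fam n → List (Target n)
lhs T = concatMap (λ { (A , Q) → map (λ { (Y , B , C) → Y , A , B , C }) (Δ Q) }) (Γ ⊤ T)

-- m^{1,3} ∘ (Γ ⊗ Γ) ∘ Δ  applied to a topology T on X,
-- with m^{1,3}(a ⊗ b ⊗ c ⊗ d) = ac ⊗ b ⊗ d
rhs : Fam n → List (Target n)
rhs T = concatMap (λ { (Y , P , Q) →
          concatMap (λ { (a , b) →
            map (λ { (c , d) → Y , product (∁ Y) Y a c , b , d }) (Γ Y Q) })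
          (Γ (∁ Y) P) })
        (Δ T)

-- Both sides are sums of basis elements with coefficients 0 or 1, so it suffices to match their
-- index sets bijectively, term by term. A summand of (I ⊗ Δ) ∘ Γ is indexed by a T-admissible T'
-- and a (T/T')-open Y; a summand of m^{1,3} ∘ (Γ ⊗ Γ) ∘ Δ by a T-open Y, a T|_{X∖Y}-admissible a
-- and a T|_Y-admissible c. The quotient preorder is generated by ≤_T and the reverse of ≤_T', so a
-- (T/T')-open Y is a ≤_T-up-set and a ≤_T'-down-set, hence T-open and T'-clopen (in a finite space
-- every up-set of the specialisation preorder is open). Therefore T' = ac with a = T'|_{X∖Y} and
-- c = T'|_Y admissible, and T/T' restricts to T|_{X∖Y}/a and T|_Y/c. Conversely, for such Y, a, c the
-- product ac is T-admissible (a connected set lies on one side of the clopen Y, and points on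
-- different sides are inequivalent in both quotients) and Y is (T/ac)-open.

module Submission where

open import Defs
open import Data.Nat using (ℕ; zero; suc)
open import Data.Bool using (Bool; true; false; _∧_; _∨_; not; T)
open import Data.Bool.Properties using (T-≡; T-not-≡; T-∧; T-∨; T?; ∧-comm)
open import Data.Bool.ListAction using (all; any)
open import Data.Empty using (⊥-elim)
open import Data.Fin using (Fin)
open import Data.Fin.Subset using (Subset; _∈_; _∉_; _⊆_; _∩_; _∪_; ∁; ⊤; ⊥; Nonempty; ⋃; ⋂)
open import Data.Fin.Subset.Properties
  using ( _∈?_; nonempty?; ⊆-antisym; ∈⊤; ∉⊥
        ; x∈p∩q⁺; x∈p∩q⁻; x∈p∪q⁺; x∈p∪q⁻; x∈∁p⇒x∉p; x∉p⇒x∈∁p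
        ; ∩-zeroˡ; ∩-identityˡ; ∩-identityʳ; ∩-comm; ∩-distribˡ-∪; ∩-distribʳ-∪; ∪-comm; p∪∁p≡⊤ )
open import Data.Vec using ([]; _∷_; head)
open import Data.Vec.Properties using ([]=⇒lookup; lookup⇒[]=; ∷-injectiveʳ)
open import Data.List using (List; []; _∷_; map; concatMap; filterᵇ; allFin)
open import Data.List.Properties using (map-id; map-∘; map-cong-local)
open import Data.List.Membership.Propositional using (lose; find) renaming (_∈_ to _∈ₗ_)
open import Data.List.Membership.Propositional.Properties
  using ( ∈-allFin; ∈-filter⁺; ∈-filter⁻; ∈-map⁺; ∈-map⁻; ∈-concatMap⁺; ∈-concatMap⁻
        ; ∈-++⁺ˡ; ∈-++⁺ʳ; ∈-cartesianProduct⁺ )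
open import Data.List.Membership.Propositional.Properties.WithK using (unique⇒irrelevant)
open import Data.List.Relation.Unary.All as All using (All; []; _∷_)
open import Data.List.Relation.Unary.All.Properties as AllP using (all⁺; all⁻)
open import Data.List.Relation.Unary.Any using (Any; here; there; satisfied)
open import Data.List.Relation.Unary.Any.Properties as AnyP using (any⁺; any⁻)
open import Data.List.Relation.Unary.AllPairs using ([]; _∷_)
open import Data.List.Relation.Unary.Unique.Propositional using (Unique)
import Data.List.Relation.Unary.Unique.Propositional.Properties as Unique
open import Data.List.Relation.Binary.BagAndSetEquality using (∼bag⇒↭)
open import Data.List.Relation.Binary.Permutation.Propositional using (_↭_)
open import Data.Product using (_×_; _,_; proj₁; proj₂; ∃; ∃₂; ∃-syntax)
open import Data.Sum as Sum using (_⊎_; inj₁; inj₂; [_,_]′)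
open import Function using (_∘_; flip; case_of_; _⇔_; mk⇔; Equivalence; mk↔ₛ′)
open import Relation.Binary.PropositionalEquality
open import Relation.Nullary using (¬_; Dec; yes; no; contradiction)

open Equivalence using (to; from)
open ≡-Reasoning

private
  variable
    n : ℕ
    X : Set

T-⇒ : ∀ {a b} → T (not a ∨ b) ⇔ (T a → T b)
T-⇒ {true}  = mk⇔ (λ b _ → b) (λ f → f _)
T-⇒ {false} = mk⇔ (λ _ ()) (λ _ → _)

T-=ᵇ : ∀ {a b} → T (a =ᵇ b) ⇔ a ≡ b
T-=ᵇ {true}  {true}  = mk⇔ (λ _ → refl) (λ _ → _)
T-=ᵇ {true}  {false} = mk⇔ (λ ()) (λ ())
T-=ᵇ {false} {true}  = mk⇔ (λ ()) (λ ())
T-=ᵇ {false} {false} = mk⇔ (λ _ → refl) (λ _ → _)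

T-ext : ∀ {a b} → (T a → T b) → (T b → T a) → a ≡ b
T-ext {true}  {true}  _ _ = refl
T-ext {true}  {false} f _ = ⊥-elim (f _)
T-ext {false} {true}  _ g = ⊥-elim (g _)
T-ext {false} {false} _ _ = refl

module Enumeration {xs : List X} (complete : ∀ x → x ∈ₗ xs) where

  all⇔∀ : (p : X → Bool) → T (all p xs) ⇔ (∀ x → T (p x))
  all⇔∀ p = mk⇔ (λ h x → All.lookup (all⁺ p xs h) (complete x))
                (λ h → all⁻ p (All.tabulate {xs = xs} (λ {x} _ → h x)))

  all⇒⇔∀ : (p q : X → Bool) → T (all (λ x → not (p x) ∨ q x) xs) ⇔ (∀ x → T (p x) → T (q x))
  all⇒⇔∀ p q = mk⇔ (λ h x → to T-⇒ (to (all⇔∀ _) h x))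
                   (λ h → from (all⇔∀ _) (λ x → from T-⇒ (h x)))

  any⇔∃ : (p : X → Bool) → T (any p xs) ⇔ ∃ (T ∘ p)
  any⇔∃ p = mk⇔ (satisfied ∘ any⁻ p xs) (λ (x , px) → any⁺ p (lose (complete x) px))

unique-sameMembers⇒↭ : {xs ys : List X} → Unique xs → Unique ys →
                       (∀ {z} → z ∈ₗ xs → z ∈ₗ ys) → (∀ {z} → z ∈ₗ ys → z ∈ₗ xs) → xs ↭ ys
unique-sameMembers⇒↭ uxs uys xs⊆ys ys⊆xs =
  ∼bag⇒↭ (mk↔ₛ′ xs⊆ys ys⊆xs (λ _ → unique⇒irrelevant uys _ _) (λ _ → unique⇒irrelevant uxs _ _))

module _ {X′ K : Set} where

  map-unique : (g : X → X′) (k : X′ → K) {κ : X → K} {xs : List X} → Unique (map κ xs) →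
               (∀ {x} → x ∈ₗ xs → k (g x) ≡ κ x) → Unique (map g xs)
  map-unique g k {κ} {xs} u keys = Unique.map⁻ (subst Unique (sym (begin
    map k (map g xs)  ≡⟨ map-∘ xs ⟨
    map (k ∘ g) xs    ≡⟨ map-cong-local (All.tabulate keys) ⟩
    map κ xs          ∎)) u)

  concatMap-unique : (f : X → List X′) (k : X′ → K) {κ : X → K} {xs : List X} → Unique (map κ xs) →
                     (∀ {x} → x ∈ₗ xs → Unique (f x)) →
                     (∀ {x t} → x ∈ₗ xs → t ∈ₗ f x → k t ≡ κ x) →
                     Unique (concatMap f xs)
  concatMap-unique f k {xs = []}     _         _  _    = []
  concatMap-unique f k {κ} {x ∷ xs} (κx∉ ∷ u) uf keys =
    Unique.++⁺ (uf (here refl)) (concatMap-unique f k u (uf ∘ there) (keys ∘ there)) λ (t∈fx , t∈rest) →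
      let x′ , x′∈xs , t∈fx′ = find (∈-concatMap⁻ f {xs = xs} t∈rest) in
      All.lookup κx∉ (∈-map⁺ κ x′∈xs) (trans (sym (keys (here refl) t∈fx)) (keys (there x′∈xs) t∈fx′))

subsets-complete : (s : Subset n) → s ∈ₗ subsets n
subsets-complete []                    = here refl
subsets-complete {suc n} (false ∷ s) = ∈-++⁺ˡ (∈-map⁺ (false ∷_) (subsets-complete s))
subsets-complete {suc n} (true  ∷ s) =
  ∈-++⁺ʳ (map (false ∷_) (subsets n)) (∈-map⁺ (true ∷_) (subsets-complete s))

allFams-complete : (F : Fam n) → F ∈ₗ allFams n
allFams-complete {zero}  false   = here refl
allFams-complete {zero}  true    = there (here refl)
allFams-complete {suc n} (f , g) = ∈-cartesianProduct⁺ (allFams-complete f) (allFams-complete g)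

subsets-unique : (n : ℕ) → Unique (subsets n)
subsets-unique zero    = [] ∷ []
subsets-unique (suc n) =
  Unique.++⁺ (Unique.map⁺ ∷-injectiveʳ (subsets-unique n))
             (Unique.map⁺ ∷-injectiveʳ (subsets-unique n)) λ (m , m′) →
    let _ , _ , e = ∈-map⁻ (false ∷_) m ; _ , _ , e′ = ∈-map⁻ (true ∷_) m′ in
    contradiction (cong head (trans (sym e) e′)) λ ()

allFams-unique : (n : ℕ) → Unique (allFams n)
allFams-unique zero    = ((λ ()) ∷ []) ∷ [] ∷ []
allFams-unique (suc n) = Unique.cartesianProduct⁺ (allFams-unique n) (allFams-unique n)

∈F-ext : {F G : Fam n} → (∀ Z → Z ∈F F ≡ Z ∈F G) → F ≡ G
∈F-ext {zero}  eq = eq []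
∈F-ext {suc n} {_ , _} {_ , _} eq = cong₂ _,_ (∈F-ext (eq ∘ (false ∷_))) (∈F-ext (eq ∘ (true ∷_)))

∈F-fromPred : (p : Subset n → Bool) (Z : Subset n) → Z ∈F fromPred p ≡ p Z
∈F-fromPred p []          = refl
∈F-fromPred p (false ∷ Z) = ∈F-fromPred (p ∘ (false ∷_)) Z
∈F-fromPred p (true  ∷ Z) = ∈F-fromPred (p ∘ (true ∷_)) Z

module _ {n : ℕ} where

  private
    variable
      x y : Fin n
      S Y Z W : Subset n
      F G : Fam n

  module Subsets = Enumeration (subsets-complete {n})
  module Points  = Enumeration (∈-allFin {n})

  ∈ᵇ⇔∈ : T (x ∈ᵇ Z) ⇔ x ∈ Z
  ∈ᵇ⇔∈ {x = x} {Z} = mk⇔ (lookup⇒[]= x Z ∘ to T-≡) (from T-≡ ∘ []=⇒lookup)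

  ⊆ᵇ⇔⊆ : T (Z ⊆ᵇ W) ⇔ Z ⊆ W
  ⊆ᵇ⇔⊆ {Z = Z} {W} = mk⇔
    (λ h {x} x∈Z → to ∈ᵇ⇔∈ (to (Points.all⇒⇔∀ (_∈ᵇ Z) (_∈ᵇ W)) h x (from ∈ᵇ⇔∈ x∈Z)))
    (λ Z⊆W → from (Points.all⇒⇔∀ (_∈ᵇ Z) (_∈ᵇ W)) λ _ x∈Z → from ∈ᵇ⇔∈ (Z⊆W (to ∈ᵇ⇔∈ x∈Z)))

  =ˢ⇔≡ : T (Z =ˢ W) ⇔ Z ≡ W
  =ˢ⇔≡ {Z = Z} {W} = mk⇔
    (λ h → let Z⊆W , W⊆Z = to (T-∧ {Z ⊆ᵇ W}) h in ⊆-antisym (to ⊆ᵇ⇔⊆ Z⊆W) (to ⊆ᵇ⇔⊆ W⊆Z))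
    (λ { refl → from T-∧ (from (⊆ᵇ⇔⊆ {Z} {Z}) (λ m → m) , from (⊆ᵇ⇔⊆ {Z} {Z}) (λ m → m)) })

  nonEmpty⇔ : T (nonEmpty Z) ⇔ Nonempty Z
  nonEmpty⇔ {Z = Z} = mk⇔
    (λ h → let x , x∈Z = to (Points.any⇔∃ (_∈ᵇ Z)) h in x , to ∈ᵇ⇔∈ x∈Z)
    (λ (x , x∈Z) → from (Points.any⇔∃ (_∈ᵇ Z)) (x , from ∈ᵇ⇔∈ x∈Z))

  ∩-distribʳ-∩ : ∀ Z W → (Z ∩ W) ∩ Y ≡ (Z ∩ Y) ∩ (W ∩ Y)
  ∩-distribʳ-∩ Z W = ⊆-antisym
    (λ m → let m₁ , y = x∈p∩q⁻ _ _ m ; z , w = x∈p∩q⁻ _ _ m₁ in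
           x∈p∩q⁺ (x∈p∩q⁺ (z , y) , x∈p∩q⁺ (w , y)))
    (λ m → let m₁ , m₂ = x∈p∩q⁻ _ _ m ; z , y = x∈p∩q⁻ _ _ m₁ in
           x∈p∩q⁺ (x∈p∩q⁺ (z , proj₁ (x∈p∩q⁻ _ _ m₂)) , y))

  p⊆q⇒p∩q≡p : Z ⊆ W → Z ∩ W ≡ Z
  p⊆q⇒p∩q≡p Z⊆W = ⊆-antisym (proj₁ ∘ x∈p∩q⁻ _ _) (λ x∈Z → x∈p∩q⁺ (x∈Z , Z⊆W x∈Z))

  disjoint⇒p∩q≡⊥ : (∀ {x} → x ∈ Z → x ∉ W) → Z ∩ W ≡ ⊥
  disjoint⇒p∩q≡⊥ disjoint = ⊆-antisym
    (λ m → let x∈Z , x∈W = x∈p∩q⁻ _ _ m in contradiction x∈W (disjoint x∈Z))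
    (λ x∈⊥ → contradiction x∈⊥ ∉⊥)

  ∁p∪p≡⊤ : ∁ Y ∪ Y ≡ ⊤
  ∁p∪p≡⊤ {Y = Y} = trans (∪-comm (∁ Y) Y) (p∪∁p≡⊤ Y)

  x∈∁p∪p : x ∈ ∁ Y ∪ Y
  x∈∁p∪p = subst (_ ∈_) (sym ∁p∪p≡⊤) ∈⊤

  -- A record rather than T (Z ∈F F), so that F and Z can be inferred from it.
  record Open (F : Fam n) (Z : Subset n) : Set where
    constructor mkOpen
    field isOpen : T (Z ∈F F)
  open Open

  infix 4 _≺_
  _≺_ : Fam n → Fam n → Set
  F ≺ G = ∀ {Z} → Open G Z → Open F Z

  ≺-antisym : F ≺ G → G ≺ F → F ≡ G
  ≺-antisym F≺G G≺F = ∈F-ext λ Z → T-ext (isOpen ∘ G≺F {Z} ∘ mkOpen) (isOpen ∘ F≺G {Z} ∘ mkOpen)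

  open-fromPred⇔ : (p : Subset n → Bool) → Open (fromPred p) Z ⇔ T (p Z)
  open-fromPred⇔ p = mk⇔ (subst T (∈F-fromPred p _) ∘ isOpen) (mkOpen ∘ subst T (sym (∈F-fromPred p _)))

  =F⇔≡ : T (F =F G) ⇔ F ≡ G
  =F⇔≡ {F = F} {G} = mk⇔
    (λ h → ∈F-ext λ Z → to T-=ᵇ (to (Subsets.all⇔∀ _) h Z))
    (λ { refl → from (Subsets.all⇔∀ _) (λ Z → from (T-=ᵇ {Z ∈F F}) refl) })

  finer⇔ : T (finer F G) ⇔ F ≺ G
  finer⇔ {F = F} {G} = mk⇔
    (λ h {Z} o → mkOpen (to (Subsets.all⇒⇔∀ (_∈F G) (_∈F F)) h Z (isOpen o)))
    (λ F≺G → from (Subsets.all⇒⇔∀ (_∈F G) (_∈F F)) (λ Z o → isOpen (F≺G {Z} (mkOpen o))))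

  -- Finite topologies and their specialisation preorder

  record IsTopology (S : Subset n) (F : Fam n) : Set where
    field
      open⊆        : ∀ {Z} → Open F Z → Z ⊆ S
      ⊥-open       : Open F ⊥
      carrier-open : Open F S
      ∪-open       : ∀ {Z W} → Open F Z → Open F W → Open F (Z ∪ W)
      ∩-open       : ∀ {Z W} → Open F Z → Open F W → Open F (Z ∩ W)
  open IsTopology

  isTopOn⇔ : T (isTopOn S F) ⇔ IsTopology S F
  isTopOn⇔ {S = S} {F} = mk⇔ toTop fromTop
    where
    bounded : Bool
    bounded = all (λ Z → not (Z ∈F F) ∨ (Z ⊆ᵇ S)) (subsets n)

    bothOpen closed : Subset n → Subset n → Bool
    bothOpen Z W = (Z ∈F F) ∧ (W ∈F F)
    closed   Z W = ((Z ∪ W) ∈F F) ∧ ((Z ∩ W) ∈F F)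

    lattice : Bool
    lattice = all (λ Z → all (λ W → not (bothOpen Z W) ∨ closed Z W) (subsets n)) (subsets n)

    bounded⇔ : T bounded ⇔ (∀ Z → Open F Z → Z ⊆ S)
    bounded⇔ = mk⇔ (λ h Z o {x} → to ⊆ᵇ⇔⊆ (to (Subsets.all⇒⇔∀ (_∈F F) (_⊆ᵇ S)) h Z (isOpen o)) {x})
                   (λ h → from (Subsets.all⇒⇔∀ (_∈F F) (_⊆ᵇ S)) (λ Z o → from ⊆ᵇ⇔⊆ (h Z (mkOpen o))))

    lattice⇔ : T lattice ⇔ (∀ Z W → T (bothOpen Z W) → T (closed Z W))
    lattice⇔ = mk⇔ (λ h Z → to (Subsets.all⇒⇔∀ _ _) (to (Subsets.all⇔∀ _) h Z))
                   (λ h → from (Subsets.all⇔∀ _) (λ Z → from (Subsets.all⇒⇔∀ (bothOpen Z) (closed Z)) (h Z)))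

    toTop : T (isTopOn S F) → IsTopology S F
    toTop h = record
      { open⊆        = λ {Z} → to bounded⇔ h₁ Z
      ; ⊥-open       = mkOpen h₂
      ; carrier-open = mkOpen h₃
      ; ∪-open       = λ {Z} {W} o o′ → mkOpen (proj₁ (to (T-∧ {(Z ∪ W) ∈F F}) (closes o o′)))
      ; ∩-open       = λ {Z} {W} o o′ → mkOpen (proj₂ (to (T-∧ {(Z ∪ W) ∈F F}) (closes o o′)))
      }
      where
      h₁ = proj₁ (to (T-∧ {bounded}) h)
      h₂ = proj₁ (to (T-∧ {⊥ ∈F F}) (proj₂ (to (T-∧ {bounded}) h)))
      h₃ = proj₁ (to (T-∧ {S ∈F F}) (proj₂ (to (T-∧ {⊥ ∈F F}) (proj₂ (to (T-∧ {bounded}) h)))))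
      h₄ = proj₂ (to (T-∧ {S ∈F F}) (proj₂ (to (T-∧ {⊥ ∈F F}) (proj₂ (to (T-∧ {bounded}) h)))))
      closes : ∀ {Z W} → Open F Z → Open F W → T (closed Z W)
      closes {Z} {W} o o′ = to lattice⇔ h₄ Z W (from T-∧ (isOpen o , isOpen o′))

    fromTop : IsTopology S F → T (isTopOn S F)
    fromTop t = from T-∧
      ( from bounded⇔ (λ Z → open⊆ t {Z})
      , from T-∧ (isOpen (⊥-open t) , from T-∧ (isOpen (carrier-open t) , from lattice⇔ closes)))
      where
      closes : ∀ Z W → T (bothOpen Z W) → T (closed Z W)
      closes Z W h = let o , o′ = to (T-∧ {Z ∈F F}) h in
        from T-∧ ( isOpen (∪-open t {Z} {W} (mkOpen o) (mkOpen o′))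
                 , isOpen (∩-open t {Z} {W} (mkOpen o) (mkOpen o′)) )

  infix 4 _≼[_]_
  _≼[_]_ : Fin n → Fam n → Fin n → Set
  x ≼[ F ] y = ∀ {Z} → Open F Z → x ∈ Z → y ∈ Z

  leq⇔ : T (leq F x y) ⇔ x ≼[ F ] y
  leq⇔ {F = F} {x} {y} = mk⇔
    (λ h {Z} o x∈Z →
      to ∈ᵇ⇔∈ (to (Subsets.all⇒⇔∀ openAt (y ∈ᵇ_)) h Z (from T-∧ (isOpen o , from ∈ᵇ⇔∈ x∈Z))))
    (λ x≼y → from (Subsets.all⇒⇔∀ openAt (y ∈ᵇ_)) λ Z h →
      let o , x∈Z = to (T-∧ {Z ∈F F}) h in from ∈ᵇ⇔∈ (x≼y {Z} (mkOpen o) (to ∈ᵇ⇔∈ x∈Z)))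
    where
    openAt : Subset n → Bool
    openAt Z = (Z ∈F F) ∧ (x ∈ᵇ Z)

  UpClosed : (Fin n → Fin n → Set) → Subset n → Set
  UpClosed R Z = ∀ {x y} → x ∈ Z → R x y → y ∈ Z

  ⋂-open : IsTopology ⊤ F → {Ws : List (Subset n)} → All (Open F) Ws → Open F (⋂ Ws)
  ⋂-open t []       = carrier-open t
  ⋂-open t (o ∷ os) = ∩-open t o (⋂-open t os)

  ⋃-open : IsTopology S F → {Ws : List (Subset n)} → All (Open F) Ws → Open F (⋃ Ws)
  ⋃-open t []       = ⊥-open t
  ⋃-open t (o ∷ os) = ∪-open t o (⋃-open t os)

  ∈⋂⁺ : {Ws : List (Subset n)} → All (x ∈_) Ws → x ∈ ⋂ Ws
  ∈⋂⁺ []       = ∈⊤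
  ∈⋂⁺ (m ∷ ms) = x∈p∩q⁺ (m , ∈⋂⁺ ms)

  ∈⋂⁻ : (Ws : List (Subset n)) → x ∈ ⋂ Ws → All (x ∈_) Ws
  ∈⋂⁻ []       _ = []
  ∈⋂⁻ (W ∷ Ws) m = let m₁ , m₂ = x∈p∩q⁻ W (⋂ Ws) m in m₁ ∷ ∈⋂⁻ Ws m₂

  ∈⋃⁺ : {Ws : List (Subset n)} → Any (x ∈_) Ws → x ∈ ⋃ Ws
  ∈⋃⁺ (here m)  = x∈p∪q⁺ (inj₁ m)
  ∈⋃⁺ (there m) = x∈p∪q⁺ (inj₂ (∈⋃⁺ m))

  ∈⋃⁻ : (Ws : List (Subset n)) → x ∈ ⋃ Ws → Any (x ∈_) Ws
  ∈⋃⁻ []       m = contradiction m ∉⊥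
  ∈⋃⁻ (W ∷ Ws) m = [ here , there ∘ ∈⋃⁻ Ws ]′ (x∈p∪q⁻ W (⋃ Ws) m)

  neighbourhoods : Fam n → Fin n → List (Subset n)
  neighbourhoods F x = filterᵇ (λ W → (W ∈F F) ∧ (x ∈ᵇ W)) (subsets n)

  minimalNeighbourhood : Fam n → Fin n → Subset n
  minimalNeighbourhood F x = ⋂ (neighbourhoods F x)

  ∈-neighbourhoods⇔ : W ∈ₗ neighbourhoods F x ⇔ (Open F W × x ∈ W)
  ∈-neighbourhoods⇔ {W = W} {F} {x} = mk⇔
    (λ m → let o , x∈W = to (T-∧ {W ∈F F}) (proj₂ (∈-filter⁻ (T? ∘ isNbhd) {xs = subsets n} m))
           in mkOpen o , to ∈ᵇ⇔∈ x∈W)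
    (λ (o , x∈W) → ∈-filter⁺ (T? ∘ isNbhd) (subsets-complete W) (from T-∧ (isOpen o , from ∈ᵇ⇔∈ x∈W)))
    where
    isNbhd : Subset n → Bool
    isNbhd W = (W ∈F F) ∧ (x ∈ᵇ W)

  minimalNeighbourhood-open : IsTopology ⊤ F → Open F (minimalNeighbourhood F x)
  minimalNeighbourhood-open t = ⋂-open t (All.tabulate (proj₁ ∘ to ∈-neighbourhoods⇔))

  ∈-minimalNeighbourhood⇔ : y ∈ minimalNeighbourhood F x ⇔ x ≼[ F ] y
  ∈-minimalNeighbourhood⇔ = mk⇔
    (λ m {Z} o x∈Z → All.lookup (∈⋂⁻ _ m) (from ∈-neighbourhoods⇔ (o , x∈Z)))
    (λ x≼y → ∈⋂⁺ (All.tabulate λ W∈ → let o , x∈W = to ∈-neighbourhoods⇔ W∈ in x≼y o x∈W))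

  -- Z is the union of the minimal neighbourhoods of its points.
  upClosed-open : IsTopology ⊤ F → UpClosed (λ x y → x ≼[ F ] y) Z → Open F Z
  upClosed-open {F = F} {Z} t closed =
    subst (Open F) ⋃≡Z (⋃-open t (AllP.map⁺ {xs = points} (All.tabulate λ _ → minimalNeighbourhood-open t)))
    where
    points : List (Fin n)
    points = filterᵇ (_∈ᵇ Z) (allFin n)

    ⋃≡Z : ⋃ (map (minimalNeighbourhood F) points) ≡ Z
    ⋃≡Z = ⊆-antisym
      (λ y∈⋃ → let x , x∈ , y∈N = find (AnyP.map⁻ (∈⋃⁻ (map (minimalNeighbourhood F) points) y∈⋃)) in
               closed (to ∈ᵇ⇔∈ (proj₂ (∈-filter⁻ (T? ∘ (_∈ᵇ Z)) {xs = allFin n} x∈)))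
                      (to ∈-minimalNeighbourhood⇔ y∈N))
      (λ {y} y∈Z → ∈⋃⁺ (AnyP.map⁺ (lose (∈-filter⁺ (T? ∘ (_∈ᵇ Z)) (∈-allFin y) (from ∈ᵇ⇔∈ y∈Z))
                                       (from ∈-minimalNeighbourhood⇔ (λ _ m → m)))))

  open-restrict⁻ : Open (restrict F Y) W → ∃[ Z ] Open F Z × Z ∩ Y ≡ W
  open-restrict⁻ {F = F} {Y} {W} o =
    let Z , h = to (Subsets.any⇔∃ _) (to (open-fromPred⇔ _) o)
        o′ , eq = to (T-∧ {Z ∈F F}) h
    in Z , mkOpen o′ , to =ˢ⇔≡ eq

  open-restrict⁺ : Open F Z → Z ∩ Y ≡ W → Open (restrict F Y) W
  open-restrict⁺ {F = F} {Z} {Y} {W} o eq =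
    from (open-fromPred⇔ _) (from (Subsets.any⇔∃ (λ Z → (Z ∈F F) ∧ ((Z ∩ Y) =ˢ W)))
      (Z , from T-∧ (isOpen o , from =ˢ⇔≡ eq)))

  module _ {X₁ X₂ : Subset n} {F₁ F₂ : Fam n} where

    open-product⁻ : Open (product X₁ X₂ F₁ F₂) Z →
                    Z ⊆ X₁ ∪ X₂ × Open F₁ (Z ∩ X₁) × Open F₂ (Z ∩ X₂)
    open-product⁻ {Z} o =
      let Z⊆ , h = to T-∧ (to (open-fromPred⇔ _) o)
          o₁ , o₂ = to (T-∧ {(Z ∩ X₁) ∈F F₁}) h
      in to ⊆ᵇ⇔⊆ Z⊆ , mkOpen o₁ , mkOpen o₂

    open-product⁺ : Z ⊆ X₁ ∪ X₂ → Open F₁ (Z ∩ X₁) → Open F₂ (Z ∩ X₂) →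
                    Open (product X₁ X₂ F₁ F₂) Z
    open-product⁺ Z⊆ o₁ o₂ =
      from (open-fromPred⇔ _) (from T-∧ (from ⊆ᵇ⇔⊆ Z⊆ , from T-∧ (isOpen o₁ , isOpen o₂)))

  ≼-restrict⁺ : y ∈ S → x ≼[ F ] y → x ≼[ restrict F S ] y
  ≼-restrict⁺ y∈S x≼y o x∈W with open-restrict⁻ o
  ... | Z , oZ , refl = x∈p∩q⁺ (x≼y oZ (proj₁ (x∈p∩q⁻ _ _ x∈W)) , y∈S)

  ≼-restrict⁻ : x ∈ S → x ≼[ restrict F S ] y → x ≼[ F ] y
  ≼-restrict⁻ x∈S x≼y {Z} o x∈Z =
    proj₁ (x∈p∩q⁻ _ _ (x≼y (open-restrict⁺ {Z = Z} o refl) (x∈p∩q⁺ (x∈Z , x∈S))))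

  sim-restrict : x ∈ S → y ∈ S → sim (restrict F S) x y ≡ sim F x y
  sim-restrict x∈S y∈S = cong₂ _∧_ (leq-restrict x∈S y∈S) (leq-restrict y∈S x∈S)
    where
    leq-restrict : x ∈ S → y ∈ S → leq (restrict F S) x y ≡ leq F x y
    leq-restrict x∈S y∈S =
      T-ext (from leq⇔ ∘ ≼-restrict⁻ x∈S ∘ to leq⇔) (from leq⇔ ∘ ≼-restrict⁺ y∈S ∘ to leq⇔)

  restrict-isTopology : IsTopology S F → Y ⊆ S → IsTopology Y (restrict F Y)
  restrict-isTopology {S = S} {F} {Y} t Y⊆S = record
    { open⊆        = λ o → case open-restrict⁻ o of λ { (_ , _ , refl) → proj₂ ∘ x∈p∩q⁻ _ _ }
    ; ⊥-open       = open-restrict⁺ (⊥-open t) (∩-zeroˡ Y)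
    ; carrier-open = open-restrict⁺ (carrier-open t) (trans (∩-comm S Y) (p⊆q⇒p∩q≡p Y⊆S))
    ; ∪-open       = λ o o′ → case open-restrict⁻ o , open-restrict⁻ o′ of λ
        { ((_ , oZ , refl) , (_ , oZ′ , refl)) → open-restrict⁺ (∪-open t oZ oZ′) (∩-distribʳ-∪ Y _ _) }
    ; ∩-open       = λ o o′ → case open-restrict⁻ o , open-restrict⁻ o′ of λ
        { ((Z , oZ , refl) , (Z′ , oZ′ , refl)) → open-restrict⁺ (∩-open t oZ oZ′) (∩-distribʳ-∩ Z Z′) }
    }

  restrict-restrict : Z ⊆ S → restrict (restrict F S) Z ≡ restrict F Z
  restrict-restrict {Z = Z} {S} Z⊆S = ≺-antisym
    (λ o → case open-restrict⁻ o of λ { (U , oU , refl) → open-restrict⁺ (open-restrict⁺ oU refl) (∩S∩Z U) })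
    (λ o → case open-restrict⁻ o of λ { (V , oV , refl) → case open-restrict⁻ oV of λ
      { (U , oU , refl) → open-restrict⁺ oU (sym (∩S∩Z U)) } })
    where
    ∩S∩Z : ∀ U → (U ∩ S) ∩ Z ≡ U ∩ Z
    ∩S∩Z U = ⊆-antisym
      (λ m → let m₁ , z = x∈p∩q⁻ _ _ m in x∈p∩q⁺ (proj₁ (x∈p∩q⁻ _ _ m₁) , z))
      (λ m → let u , z = x∈p∩q⁻ _ _ m in x∈p∩q⁺ (x∈p∩q⁺ (u , Z⊆S z) , z))

  connected-restrict : Z ⊆ S → connected (restrict F S) Z ≡ connected F Z
  connected-restrict {Z = Z} Z⊆S = cong
    (λ G → not (any (λ U → (U ⊆ᵇ Z) ∧ (U ∈F G) ∧ ((Z ∩ ∁ U) ∈F G) ∧ nonEmpty U ∧ nonEmpty (Z ∩ ∁ U))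
                    (subsets n)))
    (restrict-restrict Z⊆S)

  clopen-disconnects : Open F Y → Open F (∁ Y) → x ∈ Z → x ∈ Y → y ∈ Z → y ∉ Y → ¬ T (connected F Z)
  clopen-disconnects {F = F} {Y} {x} {Z} {y} oY o∁Y x∈Z x∈Y y∈Z y∉Y c =
    contradiction (trans (sym (to T-≡ splits)) (to T-not-≡ c)) λ ()
    where
    U = Z ∩ Y

    ∁Y∩Z≡Z∖U : ∁ Y ∩ Z ≡ Z ∩ ∁ U
    ∁Y∩Z≡Z∖U = ⊆-antisym
      (λ m → let x∈∁Y , x∈Z = x∈p∩q⁻ _ _ m in
             x∈p∩q⁺ (x∈Z , x∉p⇒x∈∁p (x∈∁p⇒x∉p x∈∁Y ∘ proj₂ ∘ x∈p∩q⁻ _ _)))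
      (λ m → let x∈Z , x∉U = x∈p∩q⁻ _ _ m in
             x∈p∩q⁺ (x∉p⇒x∈∁p (λ x∈Y → x∈∁p⇒x∉p x∉U (x∈p∩q⁺ (x∈Z , x∈Y))) , x∈Z))

    splits : T (any (λ U → (U ⊆ᵇ Z) ∧ (U ∈F restrict F Z) ∧ ((Z ∩ ∁ U) ∈F restrict F Z)
                           ∧ nonEmpty U ∧ nonEmpty (Z ∩ ∁ U)) (subsets n))
    splits = from (Subsets.any⇔∃ _) (U , from T-∧
      ( from (⊆ᵇ⇔⊆ {U} {Z}) (proj₁ ∘ x∈p∩q⁻ _ _)
      , from T-∧ (isOpen (open-restrict⁺ oY (∩-comm Y Z)) , from T-∧
        ( isOpen (open-restrict⁺ o∁Y ∁Y∩Z≡Z∖U) , from T-∧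
          ( from nonEmpty⇔ (x , x∈p∩q⁺ (x∈Z , x∈Y))
          , from nonEmpty⇔ (y , x∈p∩q⁺ (y∈Z , x∉p⇒x∈∁p (y∉Y ∘ proj₂ ∘ x∈p∩q⁻ _ _))))))))

  connected-within-clopen : Open F Y → Open F (∁ Y) → T (connected F Z) → Z ⊆ Y ⊎ Z ⊆ ∁ Y
  connected-within-clopen {Y = Y} {Z = Z} oY o∁Y c with nonempty? (Z ∩ Y)
  ... | no  Z∩Y-empty = inj₂ λ {x} x∈Z → x∉p⇒x∈∁p λ x∈Y → Z∩Y-empty (x , x∈p∩q⁺ (x∈Z , x∈Y))
  ... | yes (x , x∈Z∩Y) = let x∈Z , x∈Y = x∈p∩q⁻ _ _ x∈Z∩Y in inj₁ λ {y} y∈Z → case y ∈? Y of λ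
    { (yes y∈Y) → y∈Y
    ; (no  y∉Y) → contradiction c (clopen-disconnects oY o∁Y x∈Z x∈Y y∈Z y∉Y)
    }

  QuotientStep : Subset n → Fam n → Fam n → Fin n → Fin n → Set
  QuotientStep S F G x y = x ∈ S × y ∈ S × (x ≼[ F ] y ⊎ y ≼[ G ] x)

  reach-upClosed : (R : Fin n → Fin n → Bool) → UpClosed (λ x y → T (R x y)) Z →
                   ∀ k → UpClosed (λ x y → T (reach k R x y)) Z
  reach-upClosed R closed zero    = closed
  reach-upClosed R closed (suc k) {x} {y} x∈Z h with to (T-∨ {R x y}) h
  ... | inj₁ r = closed x∈Z r
  ... | inj₂ viaZ =
    let z , h′ = to (Points.any⇔∃ (λ z → R x z ∧ reach k R z y)) viaZ
        r , r* = to (T-∧ {R x z}) h′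
    in reach-upClosed R closed k (closed x∈Z r) r*

  reach-⊇ : (R : Fin n → Fin n → Bool) → ∀ k → T (R x y) → T (reach k R x y)
  reach-⊇ R zero    r = r
  reach-⊇ R (suc k) r = from T-∨ (inj₁ r)

  module _ {S : Subset n} {F G : Fam n} where

    private
      step : Fin n → Fin n → Bool
      step x y = (x ∈ᵇ S) ∧ (y ∈ᵇ S) ∧ (leq F x y ∨ leq G y x)

      step⇔ : T (step x y) ⇔ QuotientStep S F G x y
      step⇔ {x} {y} = mk⇔
        (λ h → let x∈S , h′ = to (T-∧ {x ∈ᵇ S}) h
                   y∈S , h″ = to (T-∧ {y ∈ᵇ S}) h′
               in to ∈ᵇ⇔∈ x∈S , to ∈ᵇ⇔∈ y∈S , Sum.map (to leq⇔) (to leq⇔) (to T-∨ h″))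
        (λ (x∈S , y∈S , r) →
          from T-∧ (from ∈ᵇ⇔∈ x∈S ,
          from T-∧ (from ∈ᵇ⇔∈ y∈S , from T-∨ (Sum.map (from leq⇔) (from leq⇔) r))))

      stepClosed : Subset n → Bool
      stepClosed Z =
        all (λ x → all (λ y → not ((x ∈ᵇ Z) ∧ transClosure step x y) ∨ (y ∈ᵇ Z)) (allFin n)) (allFin n)

      stepClosed⇔ : T (stepClosed Z) ⇔ (∀ x y → T ((x ∈ᵇ Z) ∧ transClosure step x y) → T (y ∈ᵇ Z))
      stepClosed⇔ {Z} = mk⇔
        (λ h x → to (Points.all⇒⇔∀ _ _) (to (Points.all⇔∀ _) h x))
        (λ h → from (Points.all⇔∀ _) λ x →
                 from (Points.all⇒⇔∀ (λ y → (x ∈ᵇ Z) ∧ transClosure step x y) (_∈ᵇ Z)) (h x))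

    open-quotient⁻ : Open (quotient S F G) Z → Z ⊆ S × UpClosed (QuotientStep S F G) Z
    open-quotient⁻ {Z} o =
      let Z⊆S , closed = to (T-∧ {Z ⊆ᵇ S}) (to (open-fromPred⇔ _) o)
      in to ⊆ᵇ⇔⊆ Z⊆S ,
         λ {x} {y} x∈Z r → to ∈ᵇ⇔∈ (to (stepClosed⇔ {Z}) closed x y
                             (from T-∧ (from ∈ᵇ⇔∈ x∈Z , reach-⊇ step n (from step⇔ r))))

    open-quotient⁺ : Z ⊆ S → UpClosed (QuotientStep S F G) Z → Open (quotient S F G) Z
    open-quotient⁺ {Z} Z⊆S closed =
      from (open-fromPred⇔ _) (from T-∧ (from ⊆ᵇ⇔⊆ Z⊆S , from (stepClosed⇔ {Z}) closes))
      where
      closes : ∀ x y → T ((x ∈ᵇ Z) ∧ transClosure step x y) → T (y ∈ᵇ Z)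
      closes x y h =
        let x∈Z , r* = to (T-∧ {x ∈ᵇ Z}) h
        in from ∈ᵇ⇔∈ (reach-upClosed step (λ x∈Z r → closed x∈Z (to step⇔ r)) n (to ∈ᵇ⇔∈ x∈Z) r*)

  sim-separated : Open F Y → x ∈ Y → y ∉ Y → sim F x y ≡ false
  sim-separated {F = F} {x = x} {y} oY x∈Y y∉Y with leq F x y in eq
  ... | true  = contradiction (to leq⇔ (from T-≡ eq) oY x∈Y) y∉Y
  ... | false = refl

  QuotientStep-restrict : x ∈ S → y ∈ S →
                          QuotientStep S (restrict F S) (restrict G S) x y ⇔ QuotientStep ⊤ F G x y
  QuotientStep-restrict x∈S y∈S = mk⇔
    (λ { (_ , _ , inj₁ x≼y) → ∈⊤ , ∈⊤ , inj₁ (≼-restrict⁻ x∈S x≼y)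
       ; (_ , _ , inj₂ y≼x) → ∈⊤ , ∈⊤ , inj₂ (≼-restrict⁻ y∈S y≼x) })
    (λ { (_ , _ , inj₁ x≼y) → x∈S , y∈S , inj₁ (≼-restrict⁺ y∈S x≼y)
       ; (_ , _ , inj₂ y≼x) → x∈S , y∈S , inj₂ (≼-restrict⁺ x∈S y≼x) })

  quotient-restrict-≺ : quotient S (restrict F S) (restrict G S) ≺ restrict (quotient ⊤ F G) S
  quotient-restrict-≺ o with open-restrict⁻ o
  ... | Z , oZ , refl = open-quotient⁺ (proj₂ ∘ x∈p∩q⁻ _ _) λ x∈Z∩S r@(x∈S , y∈S , _) →
    let Z-closed = proj₂ (open-quotient⁻ oZ) in
    x∈p∩q⁺ (Z-closed (proj₁ (x∈p∩q⁻ _ _ x∈Z∩S)) (to (QuotientStep-restrict x∈S y∈S) r) , y∈S)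

  module _ (Y-closed : UpClosed (QuotientStep ⊤ F G) Y) where

    restrict-quotient : restrict (quotient ⊤ F G) Y ≡ quotient Y (restrict F Y) (restrict G Y)
    restrict-quotient = ≺-antisym lift quotient-restrict-≺
      where
      lift : restrict (quotient ⊤ F G) Y ≺ quotient Y (restrict F Y) (restrict G Y)
      lift o = let W⊆Y , W-closed = open-quotient⁻ o in
        open-restrict⁺ (open-quotient⁺ (λ _ → ∈⊤) λ x∈W r →
                          W-closed x∈W (from (QuotientStep-restrict (W⊆Y x∈W) (Y-closed (W⊆Y x∈W) r)) r))
                       (p⊆q⇒p∩q≡p W⊆Y)

    restrict-quotient-∁ :
      restrict (quotient ⊤ F G) (∁ Y) ≡ quotient (∁ Y) (restrict F (∁ Y)) (restrict G (∁ Y))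
    restrict-quotient-∁ = ≺-antisym lift quotient-restrict-≺
      where
      lift : restrict (quotient ⊤ F G) (∁ Y) ≺ quotient (∁ Y) (restrict F (∁ Y)) (restrict G (∁ Y))
      lift {W} o = open-restrict⁺ (open-quotient⁺ (λ _ → ∈⊤) W∪Y-closed) W∪Y∩∁Y≡W
        where
        W⊆∁Y = proj₁ (open-quotient⁻ o)
        W-closed = proj₂ (open-quotient⁻ o)

        W∪Y-closed : UpClosed (QuotientStep ⊤ F G) (W ∪ Y)
        W∪Y-closed {x} {y} x∈W∪Y r with x∈p∪q⁻ W Y x∈W∪Y | y ∈? Y
        ... | inj₂ x∈Y | _       = x∈p∪q⁺ (inj₂ (Y-closed x∈Y r))
        ... | inj₁ _   | yes y∈Y = x∈p∪q⁺ (inj₂ y∈Y)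
        ... | inj₁ x∈W | no  y∉Y = x∈p∪q⁺ (inj₁ (W-closed x∈W
                                     (from (QuotientStep-restrict (W⊆∁Y x∈W) (x∉p⇒x∈∁p y∉Y)) r)))

        W∪Y∩∁Y≡W : (W ∪ Y) ∩ ∁ Y ≡ W
        W∪Y∩∁Y≡W = ⊆-antisym
          (λ m → let x∈W∪Y , x∈∁Y = x∈p∩q⁻ _ _ m in
                 [ (λ x∈W → x∈W) , (λ x∈Y → contradiction x∈Y (x∈∁p⇒x∉p x∈∁Y)) ]′
                   (x∈p∪q⁻ W Y x∈W∪Y))
          (λ x∈W → x∈p∩q⁺ (x∈p∪q⁺ (inj₁ x∈W) , W⊆∁Y x∈W))

  clopen-upClosed : Open F Y → Open G (∁ Y) → UpClosed (QuotientStep ⊤ F G) Y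
  clopen-upClosed oY o∁Y x∈Y (_ , _ , inj₁ x≼y) = x≼y oY x∈Y
  clopen-upClosed {Y = Y} oY o∁Y {y = y} x∈Y (_ , _ , inj₂ y≼x) with y ∈? Y
  ... | yes y∈Y = y∈Y
  ... | no  y∉Y = contradiction x∈Y (x∈∁p⇒x∉p (y≼x o∁Y (x∉p⇒x∈∁p y∉Y)))

  record Admissible (S : Subset n) (F A : Fam n) : Set where
    field
      refines            : A ≺ F
      restrict-connected : ∀ {Z} → Z ⊆ S → T (connected A Z) → restrict A Z ≡ restrict F Z
      same-classes       : ∀ {x y} → x ∈ S → y ∈ S → sim (quotient S F A) x y ≡ sim (quotient S A A) x y
  open Admissible

  admissible⇔ : {A : Fam n} → T (admissible S F A) ⇔ Admissible S F A
  admissible⇔ {S = S} {F} {A} = mk⇔ toAdm fromAdm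
    where
    connectedAgrees : Subset n → Bool
    connectedAgrees Z = not ((Z ⊆ᵇ S) ∧ connected A Z) ∨ (restrict A Z =F restrict F Z)

    classesAgree : Fin n → Fin n → Bool
    classesAgree x y = not ((x ∈ᵇ S) ∧ (y ∈ᵇ S)) ∨ (sim (quotient S F A) x y =ᵇ sim (quotient S A A) x y)

    toAdm : T (admissible S F A) → Admissible S F A
    toAdm h = record
      { refines            = to finer⇔ (proj₁ (to (T-∧ {finer A F}) h))
      ; restrict-connected = λ {Z} Z⊆S c → to =F⇔≡
          (to T-⇒ (to (Subsets.all⇔∀ connectedAgrees) h₁ Z) (from T-∧ (from ⊆ᵇ⇔⊆ Z⊆S , c)))
      ; same-classes       = λ {x} {y} x∈S y∈S → to T-=ᵇ
          (to T-⇒ (to (Points.all⇔∀ (classesAgree x)) (to (Points.all⇔∀ _) h₂ x) y)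
                  (from T-∧ (from ∈ᵇ⇔∈ x∈S , from ∈ᵇ⇔∈ y∈S)))
      }
      where
      h₁ = proj₁ (to (T-∧ {all connectedAgrees (subsets n)}) (proj₂ (to (T-∧ {finer A F}) h)))
      h₂ = proj₂ (to (T-∧ {all connectedAgrees (subsets n)}) (proj₂ (to (T-∧ {finer A F}) h)))

    fromAdm : Admissible S F A → T (admissible S F A)
    fromAdm d = from T-∧ (from finer⇔ (refines d) , from T-∧
      ( from (Subsets.all⇔∀ connectedAgrees) (λ Z → from T-⇒ λ h →
          let Z⊆S , c = to (T-∧ {Z ⊆ᵇ S}) h in from =F⇔≡ (restrict-connected d (to ⊆ᵇ⇔⊆ Z⊆S) c))
      , from (Points.all⇔∀ _) (λ x → from (Points.all⇔∀ (classesAgree x)) λ y → from T-⇒ λ h →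
          let x∈S , y∈S = to (T-∧ {x ∈ᵇ S}) h
          in from T-=ᵇ (same-classes d (to ∈ᵇ⇔∈ x∈S) (to ∈ᵇ⇔∈ y∈S)))))

  sim-quotient-restrict : restrict (quotient ⊤ F G) S ≡ quotient S (restrict F S) (restrict G S) →
                          x ∈ S → y ∈ S →
                          sim (quotient S (restrict F S) (restrict G S)) x y ≡ sim (quotient ⊤ F G) x y
  sim-quotient-restrict eq x∈S y∈S = trans (cong (λ Q → sim Q _ _) (sym eq)) (sim-restrict x∈S y∈S)

  module _ {A : Fam n}
           (FA-restrict : restrict (quotient ⊤ F A) S ≡ quotient S (restrict F S) (restrict A S))
           (AA-restrict : restrict (quotient ⊤ A A) S ≡ quotient S (restrict A S) (restrict A S)) where

    restrict-Admissible : Admissible ⊤ F A → Admissible S (restrict F S) (restrict A S)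
    restrict-Admissible d = record
      { refines            = λ o → case open-restrict⁻ o of λ { (_ , oU , refl) → open-restrict⁺ (refines d oU) refl }
      ; restrict-connected = λ {Z} Z⊆S c → begin
          restrict (restrict A S) Z  ≡⟨ restrict-restrict Z⊆S ⟩
          restrict A Z               ≡⟨ restrict-connected d (λ _ → ∈⊤) (subst T (connected-restrict Z⊆S) c) ⟩
          restrict F Z               ≡⟨ restrict-restrict Z⊆S ⟨
          restrict (restrict F S) Z  ∎
      ; same-classes       = λ {x} {y} x∈S y∈S → begin
          sim (quotient S (restrict F S) (restrict A S)) x y  ≡⟨ sim-quotient-restrict FA-restrict x∈S y∈S ⟩
          sim (quotient ⊤ F A) x y                            ≡⟨ same-classes d ∈⊤ ∈⊤ ⟩
          sim (quotient ⊤ A A) x y                            ≡⟨ sim-quotient-restrict AA-restrict x∈S y∈S ⟨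
          sim (quotient S (restrict A S) (restrict A S)) x y  ∎
      }

    same-classes-on-piece : Admissible S (restrict F S) (restrict A S) → ∀ {x y} → x ∈ S → y ∈ S →
                            sim (quotient ⊤ F A) x y ≡ sim (quotient ⊤ A A) x y
    same-classes-on-piece d {x} {y} x∈S y∈S = begin
      sim (quotient ⊤ F A) x y                            ≡⟨ sim-quotient-restrict FA-restrict x∈S y∈S ⟨
      sim (quotient S (restrict F S) (restrict A S)) x y  ≡⟨ same-classes d x∈S y∈S ⟩
      sim (quotient S (restrict A S) (restrict A S)) x y  ≡⟨ sim-quotient-restrict AA-restrict x∈S y∈S ⟩
      sim (quotient ⊤ A A) x y                            ∎

  restrict-connected-on-piece : {A : Fam n} → Admissible S (restrict F S) (restrict A S) →
                                Z ⊆ S → T (connected A Z) → restrict A Z ≡ restrict F Z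
  restrict-connected-on-piece {F = F} {Z = Z} {A} d Z⊆S c = begin
    restrict A Z               ≡⟨ restrict-restrict Z⊆S ⟨
    restrict (restrict A _) Z  ≡⟨ restrict-connected d Z⊆S (subst T (sym (connected-restrict Z⊆S)) c) ⟩
    restrict (restrict F _) Z  ≡⟨ restrict-restrict Z⊆S ⟩
    restrict F Z               ∎

  -- Splitting and gluing along a clopen set

  module _ {a c : Fam n} (ta : IsTopology (∁ Y) a) (tc : IsTopology Y c) where

    product-isTopology : IsTopology ⊤ (product (∁ Y) Y a c)
    product-isTopology = record
      { open⊆        = λ _ _ → ∈⊤
      ; ⊥-open       = open-product⁺ (λ x∈⊥ → contradiction x∈⊥ ∉⊥)
                         (subst (Open a) (sym (∩-zeroˡ _)) (⊥-open ta))
                         (subst (Open c) (sym (∩-zeroˡ _)) (⊥-open tc))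
      ; carrier-open = open-product⁺ (λ _ → x∈∁p∪p)
                         (subst (Open a) (sym (∩-identityˡ _)) (carrier-open ta))
                         (subst (Open c) (sym (∩-identityˡ _)) (carrier-open tc))
      ; ∪-open       = λ o o′ → let _ , a₁ , c₁ = open-product⁻ o ; _ , a₂ , c₂ = open-product⁻ o′ in
          open-product⁺ (λ _ → x∈∁p∪p) (subst (Open a) (sym (∩-distribʳ-∪ _ _ _)) (∪-open ta a₁ a₂))
                                       (subst (Open c) (sym (∩-distribʳ-∪ _ _ _)) (∪-open tc c₁ c₂))
      ; ∩-open       = λ o o′ → let _ , a₁ , c₁ = open-product⁻ o ; _ , a₂ , c₂ = open-product⁻ o′ in
          open-product⁺ (λ _ → x∈∁p∪p) (subst (Open a) (sym (∩-distribʳ-∩ _ _)) (∩-open ta a₁ a₂))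
                                       (subst (Open c) (sym (∩-distribʳ-∩ _ _)) (∩-open tc c₁ c₂))
      }

    open-product⁺ˡ : Open a Z → Open (product (∁ Y) Y a c) Z
    open-product⁺ˡ o = open-product⁺ (λ _ → x∈∁p∪p)
      (subst (Open a) (sym (p⊆q⇒p∩q≡p (open⊆ ta o))) o)
      (subst (Open c) (sym (disjoint⇒p∩q≡⊥ (x∈∁p⇒x∉p ∘ open⊆ ta o))) (⊥-open tc))

    open-product⁺ʳ : Open c Z → Open (product (∁ Y) Y a c) Z
    open-product⁺ʳ o = open-product⁺ (λ _ → x∈∁p∪p)
      (subst (Open a) (sym (disjoint⇒p∩q≡⊥ λ x∈Z → flip x∈∁p⇒x∉p (open⊆ tc o x∈Z))) (⊥-open ta))
      (subst (Open c) (sym (p⊆q⇒p∩q≡p (open⊆ tc o))) o)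

    restrict-product-∁ : restrict (product (∁ Y) Y a c) (∁ Y) ≡ a
    restrict-product-∁ = ≺-antisym
      (λ o → open-restrict⁺ (open-product⁺ˡ o) (p⊆q⇒p∩q≡p (open⊆ ta o)))
      (λ o → case open-restrict⁻ o of λ { (_ , oZ , refl) → proj₁ (proj₂ (open-product⁻ oZ)) })

    restrict-product : restrict (product (∁ Y) Y a c) Y ≡ c
    restrict-product = ≺-antisym
      (λ o → open-restrict⁺ (open-product⁺ʳ o) (p⊆q⇒p∩q≡p (open⊆ tc o)))
      (λ o → case open-restrict⁻ o of λ { (_ , oZ , refl) → proj₂ (proj₂ (open-product⁻ oZ)) })

    product-open : Open (product (∁ Y) Y a c) Y
    product-open = open-product⁺ʳ (carrier-open tc)

    product-open-∁ : Open (product (∁ Y) Y a c) (∁ Y)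
    product-open-∁ = open-product⁺ˡ (carrier-open ta)

  product-restrict : {A : Fam n} → IsTopology ⊤ A → Open A Y → Open A (∁ Y) →
                     product (∁ Y) Y (restrict A (∁ Y)) (restrict A Y) ≡ A
  product-restrict {Y = Y} {A} t oY o∁Y = ≺-antisym
    (λ o → open-product⁺ (λ _ → x∈∁p∪p) (open-restrict⁺ o refl) (open-restrict⁺ o refl))
    (λ {Z} o → let _ , a , c = open-product⁻ o in
      subst (Open A) (split Z) (∪-open t (open-restricted o∁Y a) (open-restricted oY c)))
    where
    open-restricted : ∀ {S W} → Open A S → Open (restrict A S) W → Open A W
    open-restricted oS o with open-restrict⁻ o
    ... | _ , oU , refl = ∩-open t oU oS

    split : ∀ Z → Z ∩ ∁ Y ∪ Z ∩ Y ≡ Z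
    split Z = begin
      Z ∩ ∁ Y ∪ Z ∩ Y  ≡⟨ ∩-distribˡ-∪ Z (∁ Y) Y ⟨
      Z ∩ (∁ Y ∪ Y)    ≡⟨ cong (Z ∩_) ∁p∪p≡⊤ ⟩
      Z ∩ ⊤            ≡⟨ ∩-identityʳ Z ⟩
      Z                ∎

  -- The summands of (I ⊗ Δ) ∘ Γ and of m^{1,3} ∘ (Γ ⊗ Γ) ∘ Δ, indexed by (T', Y) and by (Y, a, c).
  lhsTerm : Fam n → Fam n → Subset n → Target n
  lhsTerm F A Y = Y , A , restrict (quotient ⊤ F A) (∁ Y) , restrict (quotient ⊤ F A) Y

  rhsTerm : Fam n → Subset n → Fam n → Fam n → Target n
  rhsTerm F Y a c = Y , product (∁ Y) Y a c , quotient (∁ Y) (restrict F (∁ Y)) a , quotient Y (restrict F Y) c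

  module Split {F A : Fam n} {Y : Subset n} (tF : IsTopology ⊤ F) (tA : IsTopology ⊤ A)
               (dA : Admissible ⊤ F A) (Y-open-quotient : Open (quotient ⊤ F A) Y) where

    private
      FA-closed : UpClosed (QuotientStep ⊤ F A) Y
      FA-closed = proj₂ (open-quotient⁻ Y-open-quotient)

    Y-open : Open F Y
    Y-open = upClosed-open tF λ x∈Y x≼y → FA-closed x∈Y (∈⊤ , ∈⊤ , inj₁ x≼y)

    private
      ∁Y-openᴬ : Open A (∁ Y)
      ∁Y-openᴬ = upClosed-open tA λ x∈∁Y x≼y →
        x∉p⇒x∈∁p λ y∈Y → x∈∁p⇒x∉p x∈∁Y (FA-closed y∈Y (∈⊤ , ∈⊤ , inj₂ x≼y))

      Y-openᴬ : Open A Y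
      Y-openᴬ = refines dA Y-open

      AA-closed : UpClosed (QuotientStep ⊤ A A) Y
      AA-closed = clopen-upClosed Y-openᴬ ∁Y-openᴬ

    product≡ : product (∁ Y) Y (restrict A (∁ Y)) (restrict A Y) ≡ A
    product≡ = product-restrict tA Y-openᴬ ∁Y-openᴬ

    quotient-∁ : restrict (quotient ⊤ F A) (∁ Y) ≡ quotient (∁ Y) (restrict F (∁ Y)) (restrict A (∁ Y))
    quotient-∁ = restrict-quotient-∁ FA-closed

    quotient-Y : restrict (quotient ⊤ F A) Y ≡ quotient Y (restrict F Y) (restrict A Y)
    quotient-Y = restrict-quotient FA-closed

    topology-∁ : IsTopology (∁ Y) (restrict A (∁ Y))
    topology-∁ = restrict-isTopology tA (λ _ → ∈⊤)

    topology-Y : IsTopology Y (restrict A Y)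
    topology-Y = restrict-isTopology tA (λ _ → ∈⊤)

    admissible-∁ : Admissible (∁ Y) (restrict F (∁ Y)) (restrict A (∁ Y))
    admissible-∁ = restrict-Admissible quotient-∁ (restrict-quotient-∁ AA-closed) dA

    admissible-Y : Admissible Y (restrict F Y) (restrict A Y)
    admissible-Y = restrict-Admissible quotient-Y (restrict-quotient AA-closed) dA

    term≡ : rhsTerm F Y (restrict A (∁ Y)) (restrict A Y) ≡ lhsTerm F A Y
    term≡ = cong₂ (λ A′ BC → Y , A′ , BC) product≡ (sym (cong₂ _,_ quotient-∁ quotient-Y))

  module Glue {F a c : Fam n} {Y : Subset n} (Y-open : Open F Y)
              (ta : IsTopology (∁ Y) a) (da : Admissible (∁ Y) (restrict F (∁ Y)) a)
              (tc : IsTopology Y c) (dc : Admissible Y (restrict F Y) c) where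

    private
      A : Fam n
      A = product (∁ Y) Y a c

      FA-closed : UpClosed (QuotientStep ⊤ F A) Y
      FA-closed = clopen-upClosed Y-open (product-open-∁ ta tc)

      AA-closed : UpClosed (QuotientStep ⊤ A A) Y
      AA-closed = clopen-upClosed (product-open ta tc) (product-open-∁ ta tc)

      da′ : Admissible (∁ Y) (restrict F (∁ Y)) (restrict A (∁ Y))
      da′ = subst (Admissible (∁ Y) (restrict F (∁ Y))) (sym (restrict-product-∁ ta tc)) da

      dc′ : Admissible Y (restrict F Y) (restrict A Y)
      dc′ = subst (Admissible Y (restrict F Y)) (sym (restrict-product ta tc)) dc

    topology-⊤ : IsTopology ⊤ A
    topology-⊤ = product-isTopology ta tc

    Y-open-quotient : Open (quotient ⊤ F A) Y
    Y-open-quotient = open-quotient⁺ (λ _ → ∈⊤) FA-closed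

    quotient-∁ : restrict (quotient ⊤ F A) (∁ Y) ≡ quotient (∁ Y) (restrict F (∁ Y)) a
    quotient-∁ =
      trans (restrict-quotient-∁ FA-closed) (cong (quotient (∁ Y) (restrict F (∁ Y))) (restrict-product-∁ ta tc))

    quotient-Y : restrict (quotient ⊤ F A) Y ≡ quotient Y (restrict F Y) c
    quotient-Y = trans (restrict-quotient FA-closed) (cong (quotient Y (restrict F Y)) (restrict-product ta tc))

    term≡ : lhsTerm F A Y ≡ rhsTerm F Y a c
    term≡ = cong (λ BC → Y , A , BC) (cong₂ _,_ quotient-∁ quotient-Y)

    admissible-⊤ : Admissible ⊤ F A
    admissible-⊤ = record
      { refines            = λ oZ → open-product⁺ (λ _ → x∈∁p∪p) (refines da (open-restrict⁺ oZ refl))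
                                                                  (refines dc (open-restrict⁺ oZ refl))
      ; restrict-connected = λ _ c → case connected-within-clopen (product-open ta tc) (product-open-∁ ta tc) c of λ
          { (inj₁ Z⊆Y)  → restrict-connected-on-piece dc′ Z⊆Y c
          ; (inj₂ Z⊆∁Y) → restrict-connected-on-piece da′ Z⊆∁Y c
          }
      ; same-classes       = λ {x} {y} _ _ → same-classes′ (x ∈? Y) (y ∈? Y)
      }
      where
      sim-sym : ∀ Q → sim Q x y ≡ sim Q y x
      sim-sym Q = ∧-comm (leq Q _ _) (leq Q _ _)

      Q-open : Open (quotient ⊤ A A) Y
      Q-open = open-quotient⁺ (λ _ → ∈⊤) AA-closed

      same-classes′ : Dec (x ∈ Y) → Dec (y ∈ Y) → sim (quotient ⊤ F A) x y ≡ sim (quotient ⊤ A A) x y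
      same-classes′ (yes x∈Y) (yes y∈Y) =
        same-classes-on-piece (restrict-quotient FA-closed) (restrict-quotient AA-closed) dc′ x∈Y y∈Y
      same-classes′ (no x∉Y)  (no y∉Y)  =
        same-classes-on-piece (restrict-quotient-∁ FA-closed) (restrict-quotient-∁ AA-closed) da′
                              (x∉p⇒x∈∁p x∉Y) (x∉p⇒x∈∁p y∉Y)
      same-classes′ (yes x∈Y) (no y∉Y)  =
        trans (sim-separated Y-open-quotient x∈Y y∉Y) (sym (sim-separated Q-open x∈Y y∉Y))
      same-classes′ (no x∉Y)  (yes y∈Y) =
        trans (trans (sim-sym _) (sim-separated Y-open-quotient y∈Y x∉Y))
              (sym (trans (sim-sym _) (sim-separated Q-open y∈Y x∉Y)))

  -- The two sides as duplicate-free lists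

  admissibles : Subset n → Fam n → List (Fam n)
  admissibles S F = filterᵇ (admissible S F) (topsOn S)

  admissibles-unique : Unique (admissibles S F)
  admissibles-unique {S = S} {F} =
    Unique.filter⁺ (T? ∘ admissible S F) (Unique.filter⁺ (T? ∘ isTopOn S) (allFams-unique n))

  ∈-admissibles⇔ : {A : Fam n} → A ∈ₗ admissibles S F ⇔ (IsTopology S A × Admissible S F A)
  ∈-admissibles⇔ {S = S} {F} {A} = mk⇔
    (λ m → let m′ , d = ∈-filter⁻ (T? ∘ admissible S F) {xs = topsOn S} m in
           to isTopOn⇔ (proj₂ (∈-filter⁻ (T? ∘ isTopOn S) {xs = allFams n} m′)) , to admissible⇔ d)
    (λ (t , d) → ∈-filter⁺ (T? ∘ admissible S F)
                   (∈-filter⁺ (T? ∘ isTopOn S) (allFams-complete A) (from isTopOn⇔ t)) (from admissible⇔ d))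

  ∈-opens⇔ : Y ∈ₗ filterᵇ (_∈F F) (subsets n) ⇔ Open F Y
  ∈-opens⇔ {Y = Y} {F} = mk⇔
    (λ m → mkOpen (proj₂ (∈-filter⁻ (T? ∘ (_∈F F)) {xs = subsets n} m)))
    (λ o → ∈-filter⁺ (T? ∘ (_∈F F)) (subsets-complete Y) (isOpen o))

  ∈-lhs⁻ : ∀ {t} → t ∈ₗ lhs F → ∃₂ λ A Y →
           (IsTopology ⊤ A × Admissible ⊤ F A) × Open (quotient ⊤ F A) Y × t ≡ lhsTerm F A Y
  ∈-lhs⁻ {F = F} m
    with _ , AQ∈Γ , t∈  ← find (∈-concatMap⁻ _ {xs = Γ ⊤ F} m)
    with A , A∈ , refl  ← ∈-map⁻ _ AQ∈Γ
    with _ , Y∈Δ , refl ← ∈-map⁻ _ t∈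
    with Y , Y∈ , refl  ← ∈-map⁻ _ Y∈Δ
    = A , Y , to ∈-admissibles⇔ A∈ , to ∈-opens⇔ Y∈ , refl

  ∈-lhs⁺ : {A : Fam n} → IsTopology ⊤ A × Admissible ⊤ F A → Open (quotient ⊤ F A) Y →
           lhsTerm F A Y ∈ₗ lhs F
  ∈-lhs⁺ A-adm oY =
    ∈-concatMap⁺ _ (lose (∈-map⁺ _ (from ∈-admissibles⇔ A-adm)) (∈-map⁺ _ (∈-map⁺ _ (from ∈-opens⇔ oY))))

  ∈-rhs⁻ : ∀ {t} → t ∈ₗ rhs F → ∃₂ λ Y a → ∃ λ c →
           Open F Y × (IsTopology (∁ Y) a × Admissible (∁ Y) (restrict F (∁ Y)) a)
                    × (IsTopology Y c × Admissible Y (restrict F Y) c) × t ≡ rhsTerm F Y a c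
  ∈-rhs⁻ {F = F} m
    with _ , Y∈Δ , t∈    ← find (∈-concatMap⁻ _ {xs = Δ F} m)
    with Y , Y∈ , refl   ← ∈-map⁻ _ Y∈Δ
    with _ , ab∈Γ , t∈′  ← find (∈-concatMap⁻ _ {xs = Γ (∁ Y) (restrict F (∁ Y))} t∈)
    with a , a∈ , refl   ← ∈-map⁻ _ ab∈Γ
    with _ , cd∈Γ , refl ← ∈-map⁻ _ t∈′
    with c , c∈ , refl   ← ∈-map⁻ _ cd∈Γ
    = Y , a , c , to ∈-opens⇔ Y∈ , to ∈-admissibles⇔ a∈ , to ∈-admissibles⇔ c∈ , refl

  ∈-rhs⁺ : {a c : Fam n} → Open F Y → IsTopology (∁ Y) a × Admissible (∁ Y) (restrict F (∁ Y)) a →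
           IsTopology Y c × Admissible Y (restrict F Y) c → rhsTerm F Y a c ∈ₗ rhs F
  ∈-rhs⁺ oY a-adm c-adm =
    ∈-concatMap⁺ _ (lose (∈-map⁺ _ (from ∈-opens⇔ oY))
      (∈-concatMap⁺ _ (lose (∈-map⁺ _ (from ∈-admissibles⇔ a-adm))
        (∈-map⁺ _ (∈-map⁺ _ (from ∈-admissibles⇔ c-adm))))))

  Γ-keys-unique : Unique (map proj₁ (Γ S F))
  Γ-keys-unique {S = S} {F} =
    subst Unique (sym (trans (sym (map-∘ (admissibles S F))) (map-id (admissibles S F)))) (admissibles-unique {S = S} {F})

  Δ-keys-unique : Unique (map proj₁ (Δ F))
  Δ-keys-unique {F = F} =
    subst Unique (sym (trans (sym (map-∘ opens)) (map-id opens))) (Unique.filter⁺ (T? ∘ (_∈F F)) (subsets-unique n))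
    where opens = filterᵇ (_∈F F) (subsets n)

  lhs-unique : Unique (lhs F)
  lhs-unique = concatMap-unique _ (proj₁ ∘ proj₂) (Γ-keys-unique {S = ⊤})
    (λ _ → map-unique _ proj₁ Δ-keys-unique (λ _ → refl))
    (λ _ t∈ → case ∈-map⁻ _ t∈ of λ { (_ , _ , refl) → refl })

  rhsSummands : Subset n → Fam n → Fam n × Fam n → List (Target n)
  rhsSummands Y Q (a , b) = map (λ (c , d) → Y , product (∁ Y) Y a c , b , d) (Γ Y Q)

  rhsPiece : Subset n × Fam n × Fam n → List (Target n)
  rhsPiece (Y , P , Q) = concatMap (rhsSummands Y Q) (Γ (∁ Y) P)

  ∈-Γ⁻ : ∀ {p} → p ∈ₗ Γ S F → IsTopology S (proj₁ p) × Admissible S F (proj₁ p)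
  ∈-Γ⁻ p∈ with _ , A∈ , refl ← ∈-map⁻ _ p∈ = to ∈-admissibles⇔ A∈

  rhs-unique : Unique (rhs F)
  rhs-unique {F = F} = concatMap-unique rhsPiece proj₁ Δ-keys-unique piece-unique piece-key
    where
    piece-key : ∀ {w t} → w ∈ₗ Δ F → t ∈ₗ rhsPiece w → proj₁ t ≡ proj₁ w
    piece-key {Y , P , Q} _ t∈
      with _ , _ , t∈′ ← find (∈-concatMap⁻ (rhsSummands Y Q) {xs = Γ (∁ Y) P} t∈)
      with _ , _ , refl ← ∈-map⁻ _ t∈′
      = refl

    piece-unique : ∀ {w} → w ∈ₗ Δ F → Unique (rhsPiece w)
    piece-unique w∈ with Y , _ , refl ← ∈-map⁻ _ w∈ =
      concatMap-unique (rhsSummands Y (restrict F Y)) (λ t → restrict (proj₁ (proj₂ t)) (∁ Y))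
        (Γ-keys-unique {S = ∁ Y} {restrict F (∁ Y)})
        (λ ab∈ → map-unique _ (λ t → restrict (proj₁ (proj₂ t)) Y) (Γ-keys-unique {S = Y} {restrict F Y})
                   λ cd∈ → restrict-product (proj₁ (∈-Γ⁻ ab∈)) (proj₁ (∈-Γ⁻ cd∈)))
        (λ ab∈ t∈ → case ∈-map⁻ _ t∈ of λ { (_ , cd∈ , refl) →
                      restrict-product-∁ (proj₁ (∈-Γ⁻ ab∈)) (proj₁ (∈-Γ⁻ cd∈)) })

  lhs⊆rhs : IsTopology ⊤ F → ∀ {t} → t ∈ₗ lhs F → t ∈ₗ rhs F
  lhs⊆rhs tF m with A , Y , (tA , dA) , oQ , refl ← ∈-lhs⁻ m =
    subst (_∈ₗ rhs _) term≡ (∈-rhs⁺ Y-open (topology-∁ , admissible-∁) (topology-Y , admissible-Y))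
    where open Split tF tA dA oQ

  rhs⊆lhs : ∀ {t} → t ∈ₗ rhs F → t ∈ₗ lhs F
  rhs⊆lhs m with Y , a , c , oY , (ta , da) , (tc , dc) , refl ← ∈-rhs⁻ m =
    subst (_∈ₗ lhs _) term≡ (∈-lhs⁺ (topology-⊤ , admissible-⊤) Y-open-quotient)
    where open Glue oY ta da tc dc

theorem3p5 : (n : ℕ) (T : Fam n) → isTopOn ⊤ T ≡ true → lhs T ↭ rhs T
theorem3p5 n F isTop =
  unique-sameMembers⇒↭ lhs-unique rhs-unique (lhs⊆rhs (to isTopOn⇔ (from T-≡ isTop))) rhs⊆lhs
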